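{- Let $(D,\sqsubseteq)$ be a finite partial ordering with least element $\bot$ and greatest element $\top$, and let $F$ be a finite set of inflationary and monotonic functions on $D$. Suppose the least common fixpoint $d_0$ of the functions in $F$ is computed by an execution of the RGI algorithm described in the context (with lists $\mathit{friends}(g,d)$, $\mathit{obviated}(g,d)$ satisfying condition (*) and $\mathit{update}$ satisfying (A), (B), (C)), and let $F_{\mathit{fin}}$ be the final value of the variable $F$ upon termination. Let $e\in D$ with $d_0\sqsubseteq e$. Then the least common fixpoint $\sqsupseteq e$ of the functions in $F$ coincides with the least common fixpoint $\sqsupseteq e$ of the functions in $F_{\mathit{fin}}$.
   Context: A function $f:D\to D$ is inflationary if $x\sqsubseteq f(x)$ for all $x$, and monotonic if $x\sqsubseteq y$ implies $f(x)\sqsubseteq f(y)$. RGI algorithm: $d:=\bot$; $F_0:=F$; $G:=F$; while $G\neq\emptyset$ and $d\neq\top$ do: choose $g\in G$; $G:=G-\{g\}$; $F:=F-(\mathit{friends}(g,d)\cup\mathit{obviated}(g,d))$; $G:=G-(\mathit{friends}(g,d)\cup\mathit{obviated}(g,d))$; $G:=G\cup\mathit{update}(G,h,d)$, where $\mathit{friends}(g,d)=[g_1,\ldots,g_k]$ and $h=g\circ g_1\circ\cdots\circ g_k$; $d:=h(d)$; end. Here for each $g\in F$, $d\in D$, $\mathit{friends}(g,d)$ and $\mathit{obviated}(g,d)$ are lists of functions from $F$ satisfying condition (*): for all $g\in F$, $d\in D$, with $\mathit{friends}(g,d)=[g_1,\ldots,g_k]$, every $f\in\mathit{friends}(g,d)\cup\mathit{obviated}(g,d)$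 satisfies $f(e)=e$ for all $e\sqsupseteq g\circ g_1\circ\cdots\circ g_k(d)$. And $\mathit{update}(G,h,d)$ is a subset of the current $F$ with: (A) $\{f\in F-G\mid f(d)=d\wedge f(h(d))\neq h(d)\}\subseteq\mathit{update}(G,h,d)$; (B) $h(d)=d$ implies $\mathit{update}(G,h,d)=\emptyset$; (C) $h(h(d))\neq h(d)$ implies $h\in\mathit{update}(G,h,d)$. -}

module Defs where

open import Data.Nat using (ℕ)
open import Data.Fin using (Fin)
open import Data.Fin.Subset as S using (Subset; _∈_; _∉_; _⊆_; _∪_; _─_; ⁅_⁆)
open import Data.List using (List; []; _∷_; _++_; foldr)
open import Data.Product using (Σ; _×_; ∃)
open import Data.Sum using (_⊎_)
open import Function using (_∘_; id; _↔_)
open import Relation.Binary.PropositionalEquality using (_≡_; _≢_; _≗_)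

Finite : Set → Set
Finite D = Σ ℕ λ n → D ↔ Fin n

module _ {D : Set} (_⊑_ : D → D → Set) where

  Inflationary : (D → D) → Set
  Inflationary f = ∀ x → x ⊑ f x

  Monotonic : (D → D) → Set
  Monotonic f = ∀ x y → x ⊑ y → f x ⊑ f y

  IsLeastCommonFixpointAbove : {m : ℕ} → (Fin m → D → D) → Subset m → D → D → Set
  IsLeastCommonFixpointAbove fs S e x =
    (e ⊑ x) × (∀ i → i ∈ S → fs i x ≡ x) ×
    (∀ y → e ⊑ y → (∀ i → i ∈ S → fs i y ≡ y) → x ⊑ y)

listToSubset : {m : ℕ} → List (Fin m) → Subset m
listToSubset = foldr (λ i s → ⁅ i ⁆ ∪ s) S.⊥

compose : {D : Set} {m : ℕ} → (Fin m → D → D) → List (Fin m) → D → D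
compose fs []       = id
compose fs (i ∷ is) = fs i ∘ compose fs is

-- The RGI algorithm, for a family of functions fs indexed by Fin m
-- (the set F of functions is {fs i | i : Fin m}; subsets of F are Subset m).
module RGI {D : Set} (⊤ᴰ : D) {m : ℕ} (fs : Fin m → D → D)
           (friends obviated : Fin m → D → List (Fin m))
           -- update takes the current F, the current G, h and d
           (update : Subset m → Subset m → (D → D) → D → Subset m) where

  Cond* : (_⊑_ : D → D → Set) → Set
  Cond* _⊑_ = ∀ g d → ∀ f → f ∈ listToSubset (friends g d ++ obviated g d) →
    ∀ e → (fs g ∘ compose fs (friends g d)) d ⊑ e → fs f e ≡ e

  record State : Set where
    constructor ⟨_,_,_⟩
    field
      d : D
      F : Subset m
      G : Subset m

  initial : D → State
  initial ⊥ᴰ = ⟨ ⊥ᴰ , S.⊤ , S.⊤ ⟩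

  data Step : State → State → Set where
    step : ∀ {d F G} (g : Fin m) → g ∈ G → d ≢ ⊤ᴰ →
      let R  = listToSubset (friends g d ++ obviated g d)
          h  = fs g ∘ compose fs (friends g d)
          F' = F ─ R
          G₁ = (G ─ ⁅ g ⁆) ─ R
          U  = update F' G₁ h d
      in
      U ⊆ F' →
      -- (A)
      (∀ f → f ∈ F' → f ∉ G₁ → fs f d ≡ d → fs f (h d) ≢ h d → f ∈ U) →
      -- (B)
      (h d ≡ d → ∀ f → f ∉ U) →
      -- (C)
      (h (h d) ≢ h d → ∃ λ i → i ∈ U × (fs i ≗ h)) →
      Step ⟨ d , F , G ⟩ ⟨ h d , F' , G₁ ∪ U ⟩

  Terminated : State → Set
  Terminated s = (∀ f → f ∉ State.G s) ⊎ State.d s ≡ ⊤ᴰ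

-- A function is only ever dropped from F when it fixes every point above the current
-- value of d (condition (*)), and d only grows, so every dropped function fixes every
-- point above the final d = d₀. Hence above e ⊒ d₀ the common fixpoints of F_fin and
-- of F are the same points, and so are their least elements. Such a least element
-- exists because D is finite: iterating the composite of all functions of F from e
-- stabilises after |D| steps.
module Submission where

open import Defs
open import Data.Nat using (ℕ; zero; suc; _≤_; _<_; _∸_; _+_)
open import Data.Nat.Properties using (m∸n+n≡m; ≤-pred; n<1+n)
open import Data.Nat.GeneralisedArithmetic using (fold; fold-+)
open import Data.Fin using (Fin; toℕ)
open import Data.Fin.Properties using (pigeonhole; toℕ<n)
open import Data.Fin.Subset using (Subset; ⊤; _∈_; _∉_; _─_)
open import Data.Fin.Subset.Properties using (_∈?_; ∈⊤; x∈p∧x∉q⇒x∈p─q)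
open import Data.List using (List; []; _∷_; allFin)
open import Data.List.Membership.Propositional using () renaming (_∈_ to _∈ₗ_)
open import Data.List.Membership.Propositional.Properties using (∈-allFin)
open import Data.List.Relation.Unary.Any using (here; there)
open import Data.Product using (∃; _×_; _,_)
open import Data.Sum using (_⊎_; inj₁; inj₂)
open import Function using (_∘_; _↔_; Inverse; Injection)
open import Function.Properties.Inverse using (↔⇒↣)
open import Relation.Nullary using (yes; no; contradiction)
open import Relation.Binary using (IsPartialOrder)
open import Relation.Binary.PropositionalEquality
  using (_≡_; _≗_; refl; sym; cong; subst; module ≡-Reasoning)
  renaming (trans to ≡-trans)
open import Relation.Binary.Construct.Closure.ReflexiveTransitive using (Star; ε; _◅_)

x∉p─q⇒x∉p⊎x∈q : ∀ {n} {p q : Subset n} {x} → x ∉ p ─ q → x ∉ p ⊎ x ∈ q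
x∉p─q⇒x∉p⊎x∈q {p = p} {q} {x} x∉p─q with x ∈? p | x ∈? q
... | no x∉p  | _       = inj₁ x∉p
... | yes _   | yes x∈q = inj₂ x∈q
... | yes x∈p | no x∉q  = contradiction (x∈p∧x∉q⇒x∈p─q x∈p x∉q) x∉p─q

module _ {D : Set} {_⊑_ : D → D → Set} (⊑-po : IsPartialOrder _≡_ _⊑_) where
  open IsPartialOrder ⊑-po using (antisym; trans) renaming (refl to ⊑-refl)
  open ≡-Reasoning

  fold-inflationary : ∀ {f} → Inflationary _⊑_ f → ∀ x k → x ⊑ fold x f k
  fold-inflationary f-infl x zero    = ⊑-refl
  fold-inflationary f-infl x (suc k) = trans (fold-inflationary f-infl x k) (f-infl _)

  fold-fixpoint : ∀ {f : D → D} {x} → f x ≡ x → ∀ k → fold x f k ≡ x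
  fold-fixpoint fx zero        = refl
  fold-fixpoint {f} fx (suc k) = ≡-trans (cong f (fold-fixpoint fx k)) fx

  fold-least : ∀ {f} → Monotonic _⊑_ f → ∀ {x y} → x ⊑ y → f y ≡ y → ∀ k → fold x f k ⊑ y
  fold-least f-mono x⊑y fy zero    = x⊑y
  fold-least f-mono x⊑y fy (suc k) = subst (_ ⊑_) fy (f-mono _ _ (fold-least f-mono x⊑y fy k))

  fold-stable : ∀ {f} x {i j} → f (fold x f i) ≡ fold x f i → i ≤ j → fold x f j ≡ fold x f i
  fold-stable {f} x {i} {j} fixᵢ i≤j = begin
    fold x f j                  ≡⟨ cong (fold x f) (m∸n+n≡m i≤j) ⟨
    fold x f (j ∸ i + i)        ≡⟨ fold-+ x f (j ∸ i) ⟩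
    fold (fold x f i) f (j ∸ i) ≡⟨ fold-fixpoint fixᵢ (j ∸ i) ⟩
    fold x f i                  ∎

  fold-repeat⇒fixpoint : ∀ {f} → Inflationary _⊑_ f → ∀ x {i j} → i < j →
                         fold x f i ≡ fold x f j → f (fold x f i) ≡ fold x f i
  fold-repeat⇒fixpoint {f} f-infl x {i} {j} i<j repeat = antisym fᵢ₊₁⊑fᵢ (f-infl _)
    where
    k = j ∸ suc i
    fᵢ₊₁⊑fᵢ : fold x f (suc i) ⊑ fold x f i
    fᵢ₊₁⊑fᵢ = subst (fold x f (suc i) ⊑_)
      (begin
        fold (fold x f (suc i)) f k ≡⟨ fold-+ x f k ⟨
        fold x f (k + suc i)        ≡⟨ cong (fold x f) (m∸n+n≡m i<j) ⟩
        fold x f j                  ≡⟨ repeat ⟨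
        fold x f i                  ∎)
      (fold-inflationary f-infl _ k)

  -- Among the n + 1 iterates fⁱ x, i ≤ n, two coincide.
  fold-stationary : ∀ {n f} → D ↔ Fin n → Inflationary _⊑_ f → ∀ x → f (fold x f n) ≡ fold x f n
  fold-stationary {n} {f} D↔Fin f-infl x
    with i , j , i<j , same ← pigeonhole (n<1+n n) (Inverse.to D↔Fin ∘ fold x f ∘ toℕ) =
    let fixᵢ = fold-repeat⇒fixpoint f-infl x i<j (Injection.injective (↔⇒↣ D↔Fin) same)
    in subst (λ a → f a ≡ a) (sym (fold-stable x fixᵢ (≤-pred (toℕ<n i)))) fixᵢ

  module _ {m} {fs : Fin m → D → D} (infl : ∀ i → Inflationary _⊑_ (fs i)) where

    compose-inflationary : ∀ is → Inflationary _⊑_ (compose fs is)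
    compose-inflationary []       x = ⊑-refl
    compose-inflationary (i ∷ is) x = trans (compose-inflationary is x) (infl i _)

    compose-monotonic : (∀ i → Monotonic _⊑_ (fs i)) → ∀ is → Monotonic _⊑_ (compose fs is)
    compose-monotonic mono []       x y x⊑y = x⊑y
    compose-monotonic mono (i ∷ is) x y x⊑y = mono i _ _ (compose-monotonic mono is x y x⊑y)

    compose-fixpoint : ∀ {x} → (∀ i → fs i x ≡ x) → ∀ is → compose fs is x ≡ x
    compose-fixpoint fix []       = refl
    compose-fixpoint fix (i ∷ is) = ≡-trans (cong (fs i) (compose-fixpoint fix is)) (fix i)

    compose-fixpoint⇒fixpoint : ∀ {x} is → compose fs is x ≡ x → ∀ {i} → i ∈ₗ is → fs i x ≡ x
    compose-fixpoint⇒fixpoint {x} (j ∷ is) fix = fixed-by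
      where
      fixed-by-rest : compose fs is x ≡ x
      fixed-by-rest = antisym (subst (compose fs is x ⊑_) fix (infl j _)) (compose-inflationary is x)

      fixed-by : ∀ {i} → i ∈ₗ j ∷ is → fs i x ≡ x
      fixed-by (here refl)  = subst (λ z → fs j z ≡ x) fixed-by-rest fix
      fixed-by (there i∈is) = compose-fixpoint⇒fixpoint is fixed-by-rest i∈is

  leastCommonFixpointAbove : ∀ {n m} {fs : Fin m → D → D} → D ↔ Fin n →
    (∀ i → Inflationary _⊑_ (fs i)) → (∀ i → Monotonic _⊑_ (fs i)) →
    ∀ e → ∃ λ x → IsLeastCommonFixpointAbove _⊑_ fs ⊤ e x
  leastCommonFixpointAbove {n} {m} {fs} D↔Fin infl mono e =
    fold e φ n , fold-inflationary φ-infl e n , fixed-by-all , least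
    where
    φ = compose fs (allFin m)
    φ-infl = compose-inflationary infl (allFin m)

    fixed-by-all : ∀ i → i ∈ ⊤ → fs i (fold e φ n) ≡ fold e φ n
    fixed-by-all i _ = compose-fixpoint⇒fixpoint infl (allFin m)
                         (fold-stationary D↔Fin φ-infl e) (∈-allFin i)

    least : ∀ y → e ⊑ y → (∀ i → i ∈ ⊤ → fs i y ≡ y) → fold e φ n ⊑ y
    least y e⊑y fix = fold-least (compose-monotonic infl mono (allFin m)) e⊑y
                        (compose-fixpoint infl (λ i → fix i ∈⊤) (allFin m)) n

  leastCommonFixpointAbove-⊆ : ∀ {m} {fs : Fin m → D → D} {F e x} →
    IsLeastCommonFixpointAbove _⊑_ fs ⊤ e x →
    (∀ y → e ⊑ y → (∀ i → i ∈ F → fs i y ≡ y) → ∀ i → fs i y ≡ y) →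
    IsLeastCommonFixpointAbove _⊑_ fs F e x
  leastCommonFixpointAbove-⊆ (e⊑x , fixed , least) F-fixed⇒fixed =
    e⊑x , (λ i _ → fixed i ∈⊤) , λ y e⊑y F-fix → least y e⊑y (λ i _ → F-fixed⇒fixed y e⊑y F-fix i)

  module RGI-invariant (⊤ᴰ : D) {m} {fs : Fin m → D → D} (infl : ∀ i → Inflationary _⊑_ (fs i))
    (friends obviated : Fin m → D → List (Fin m)) (update : Subset m → Subset m → (D → D) → D → Subset m)
    (cond : RGI.Cond* ⊤ᴰ fs friends obviated update _⊑_) where
    open RGI ⊤ᴰ fs friends obviated update

    FixesAbove : D → Fin m → Set
    FixesAbove d f = ∀ y → d ⊑ y → fs f y ≡ y

    RemovedFixAbove : State → Set
    RemovedFixAbove ⟨ d , F , _ ⟩ = ∀ f → f ∉ F → FixesAbove d f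

    initial-removedFixAbove : ∀ ⊥ᴰ → RemovedFixAbove (initial ⊥ᴰ)
    initial-removedFixAbove ⊥ᴰ f f∉⊤ = contradiction ∈⊤ f∉⊤

    step-removedFixAbove : ∀ {t u} → Step t u → RemovedFixAbove t → RemovedFixAbove u
    step-removedFixAbove {⟨ d , F , _ ⟩} (step g _ _ _ _ _ _) removed f f∉F′ y hd⊑y
      with x∉p─q⇒x∉p⊎x∈q f∉F′
    ... | inj₁ f∉F = removed f f∉F y (trans (compose-inflationary infl (g ∷ friends g d) d) hd⊑y)
    ... | inj₂ f∈R = cond g d f f∈R y hd⊑y

    reachable-removedFixAbove : ∀ {⊥ᴰ t} → Star Step (initial ⊥ᴰ) t → RemovedFixAbove t
    reachable-removedFixAbove {⊥ᴰ} = go (initial-removedFixAbove ⊥ᴰ)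
      where
      go : ∀ {t u} → RemovedFixAbove t → Star Step t u → RemovedFixAbove u
      go removed ε          = removed
      go removed (st ◅ run) = go (step-removedFixAbove st removed) run

    reachable-F-fixpoint⇒fixpoint : ∀ {⊥ᴰ t e} → Star Step (initial ⊥ᴰ) t → State.d t ⊑ e →
      ∀ y → e ⊑ y → (∀ i → i ∈ State.F t → fs i y ≡ y) → ∀ i → fs i y ≡ y
    reachable-F-fixpoint⇒fixpoint {t = t} run d⊑e y e⊑y F-fix i with i ∈? State.F t
    ... | yes i∈F = F-fix i i∈F
    ... | no  i∉F = reachable-removedFixAbove run i i∉F y (trans d⊑e e⊑y)

theorem4 : {D : Set} (_⊑_ : D → D → Set) → IsPartialOrder _≡_ _⊑_ → Finite D →
    (⊥ᴰ ⊤ᴰ : D) → (∀ x → ⊥ᴰ ⊑ x) → (∀ x → x ⊑ ⊤ᴰ) →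
    {m : ℕ} (fs : Fin m → D → D) → (∀ i j → fs i ≗ fs j → i ≡ j) →
    (∀ i → Inflationary _⊑_ (fs i)) → (∀ i → Monotonic _⊑_ (fs i)) →
    (friends obviated : Fin m → D → List (Fin m)) →
    (update : Subset m → Subset m → (D → D) → D → Subset m) →
    RGI.Cond* ⊤ᴰ fs friends obviated update _⊑_ →
    (d₀ : D) → IsLeastCommonFixpointAbove _⊑_ fs Data.Fin.Subset.⊤ ⊥ᴰ d₀ →
    (s : RGI.State ⊤ᴰ fs friends obviated update) →
    Star (RGI.Step ⊤ᴰ fs friends obviated update) (RGI.initial ⊤ᴰ fs friends obviated update ⊥ᴰ) s →
    RGI.Terminated ⊤ᴰ fs friends obviated update s →
    RGI.State.d s ≡ d₀ →
    (e : D) → d₀ ⊑ e →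
    ∃ λ x → IsLeastCommonFixpointAbove _⊑_ fs Data.Fin.Subset.⊤ e x ×
            IsLeastCommonFixpointAbove _⊑_ fs (RGI.State.F s) e x
theorem4 _⊑_ ⊑-po (_ , D↔Fin) _ ⊤ᴰ _ _ fs _ infl mono friends obviated update cond d₀ _ s run _ d≡d₀ e d₀⊑e
  with x , x-least ← leastCommonFixpointAbove ⊑-po D↔Fin infl mono e =
  x , x-least , leastCommonFixpointAbove-⊆ ⊑-po x-least
                  (reachable-F-fixpoint⇒fixpoint run (subst (_⊑ e) (sym d≡d₀) d₀⊑e))
  where open RGI-invariant ⊑-po ⊤ᴰ infl friends obviated update cond
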